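{- (1) Every prime $\ell\in\mathbb{Z}$ with $\ell\mid q$ splits in $\mathbb{Z}[\tau]$. (2) Let $w\ge2$ be an integer. If $a,b$ are integers with $a+b\tau=\tau^w$ or $a+b\tau=\bar\tau^w$, then $\gcd(a,b)=1$.
   Context: Let $q\ge2$ be an integer, $p\in\{ -1,1\}$ and $\tau=\frac p2+i\sqrt{q-\frac14}$ (a root of $X^2-pX+q$), with complex conjugate $\bar\tau$; $\mathbb{Z}[\tau]=\{x+y\tau:x,y\in\mathbb{Z}\}$. -}

module Defs where

open import Data.Nat using (ℕ; zero; suc)
open import Data.Integer using (ℤ; +_; -_; _+_; _-_; _*_; 0ℤ; 1ℤ; -1ℤ)
open import Data.Product using (Σ; ∃; _×_; _,_)
open import Data.Sum using (_⊎_)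
open import Relation.Nullary using (¬_)
open import Relation.Binary.PropositionalEquality using (_≡_)

-- Elements x + y τ of ℤ[τ], τ a root of X² - p X + q (τ non-real, so
-- 1, τ are ℤ-linearly independent and the representation is unique).
record Zτ : Set where
  constructor mk
  field
    re : ℤ
    im : ℤ

module Arith (p q : ℤ) where
  zer one τ τbar : Zτ
  zer = mk 0ℤ 0ℤ
  one = mk 1ℤ 0ℤ
  τ = mk 0ℤ 1ℤ
  τbar = mk p -1ℤ

  add : Zτ → Zτ → Zτ
  add (mk x y) (mk u v) = mk (x + u) (y + v)

  -- (x + yτ)(u + vτ) using τ² = pτ - q
  mul : Zτ → Zτ → Zτ
  mul (mk x y) (mk u v) = mk (x * u - q * (y * v)) (x * v + y * u + p * (y * v))

  pow : Zτ → ℕ → Zτ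
  pow x zero = one
  pow x (suc n) = mul x (pow x n)

  Subset : Set₁
  Subset = Zτ → Set

  IsIdeal : Subset → Set
  IsIdeal I = I zer × (∀ a b → I a → I b → I (add a b)) × (∀ r a → I a → I (mul r a))

  IsPrimeIdeal : Subset → Set
  IsPrimeIdeal P = IsIdeal P × ¬ P one × (∀ a b → P (mul a b) → P a ⊎ P b)

  _≐_ : Subset → Subset → Set
  I ≐ J = ∀ x → (I x → J x) × (J x → I x)

  data Prod (I J : Subset) : Subset where
    pzero : Prod I J zer
    pgen : ∀ {a b} → I a → J b → Prod I J (mul a b)
    padd : ∀ {x y} → Prod I J x → Prod I J y → Prod I J (add x y)

  principal : ℤ → Subset
  principal n x = Σ Zτ λ r → x ≡ mul (mk n 0ℤ) r

  Splits : ℕ → Set₁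
  Splits ℓ = Σ Subset λ P₁ → Σ Subset λ P₂ →
    IsPrimeIdeal P₁ × IsPrimeIdeal P₂ × ¬ (P₁ ≐ P₂) × (principal (+ ℓ) ≐ Prod P₁ P₂)

-- Let ℓ be a prime dividing q. Since τ τ̄ = q ≡ 0 and τ + τ̄ = p, the assignments τ ↦ 0 and
-- τ ↦ p (the two roots of X² - pX + q modulo ℓ) give ring maps ℤ[τ] → 𝔽_ℓ, whose kernels
-- P₁ = (ℓ, τ) and P₂ = (ℓ, τ̄) are distinct prime ideals. As pτ + pτ̄ = p² = 1, the ideals are
-- comaximal, so P₁ P₂ = P₁ ∩ P₂ = ℓ ℤ[τ]. For (2), a prime ℓ dividing a and b divides the norm
-- q^w of a + bτ, hence q; then a + bτ ∈ ℓ ℤ[τ] ⊆ P₁ ∩ P₂, whereas τ^w ∉ P₂ and τ̄^w ∉ P₁.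
module Submission where

open import Defs
open import Data.Nat using (ℕ; _≤_)
open import Data.Nat.Divisibility using (_∣_)
open import Data.Nat.Primality using (Prime)
open import Data.Integer using (ℤ; +_; 1ℤ; -1ℤ)
open import Data.Integer.GCD using (gcd)
open import Data.Product using (_×_)
open import Data.Sum using (_⊎_)
open import Relation.Binary.PropositionalEquality using (_≡_)

open import Data.Nat using (zero; suc; NonTrivial; nonTrivial⇒n>1; nonTrivial⇒nonZero)
open import Data.Nat.Properties using (<⇒≢)
open import Data.Nat.Divisibility using (_∣0; ∣-trans; ∣1⇒≡1; m∣m*n)
open import Data.Nat.Coprimality using (Coprime; coprime⇒gcd≡1)
open import Data.Nat.Primality using (euclidsLemma; prime⇒nonTrivial; prime[2])
open import Data.Nat.Primality.Factorisation using (factorise)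
open import Data.Nat.ListAction using (product)
open import Data.List using ([]; _∷_)
open import Data.List.Relation.Unary.All using (_∷_)
open import Data.Integer using (_+_; _-_; _*_; -_; _^_; 0ℤ; ∣_∣)
open import Data.Integer.Properties using (abs-*; +-identityˡ; +-identityʳ; *-identityʳ; *-zeroʳ)
import Data.Integer.Divisibility.Signed as ℤ
open import Data.Integer.Divisibility.Signed
  using (divides; ∣ᵤ⇒∣; ∣⇒∣ᵤ; ∣-refl; ∣m∣n⇒∣m+n; ∣m∣n⇒∣m-n; ∣m+n∣m⇒∣n; ∣m+n∣n⇒∣m; ∣m⇒∣-m; ∣n⇒∣m*n; ∣m⇒∣m*n)
open import Data.Integer.Tactic.RingSolver using (solve-∀)
open import Data.Product using (∃; _,_; proj₁; proj₂)
open import Data.Sum using (inj₁; inj₂)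
open import Data.Empty using (⊥; ⊥-elim)
open import Relation.Nullary using (¬_)
open import Relation.Binary.PropositionalEquality using (refl; sym; trans; cong; cong₂; subst; module ≡-Reasoning)

prime⇒∤1 : ∀ {ℓ} → Prime ℓ → ¬ (+ ℓ ℤ.∣ 1ℤ)
prime⇒∤1 {ℓ} ℓ-prime ℓ∣1 =
  <⇒≢ (nonTrivial⇒n>1 ℓ {{prime⇒nonTrivial ℓ-prime}}) (sym (∣1⇒≡1 (∣⇒∣ᵤ ℓ∣1)))

prime⇒∤±1 : ∀ {ℓ u} → Prime ℓ → u ≡ 1ℤ ⊎ u ≡ -1ℤ → ¬ (+ ℓ ℤ.∣ u)
prime⇒∤±1 ℓ-prime (inj₁ refl) = prime⇒∤1 ℓ-prime
prime⇒∤±1 ℓ-prime (inj₂ refl) ℓ∣-1 = prime⇒∤1 ℓ-prime (∣ᵤ⇒∣ (∣⇒∣ᵤ ℓ∣-1))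

1-u²≡0 : ∀ {u} → u ≡ 1ℤ ⊎ u ≡ -1ℤ → 1ℤ + u * - u ≡ 0ℤ
1-u²≡0 (inj₁ refl) = refl
1-u²≡0 (inj₂ refl) = refl

euclidsLemmaℤ : ∀ {ℓ} m n → Prime ℓ → + ℓ ℤ.∣ m * n → + ℓ ℤ.∣ m ⊎ + ℓ ℤ.∣ n
euclidsLemmaℤ {ℓ} m n ℓ-prime ℓ∣mn
  with euclidsLemma ∣ m ∣ ∣ n ∣ ℓ-prime (subst (ℓ ∣_) (abs-* m n) (∣⇒∣ᵤ ℓ∣mn))
... | inj₁ ℓ∣m = inj₁ (∣ᵤ⇒∣ ℓ∣m)
... | inj₂ ℓ∣n = inj₂ (∣ᵤ⇒∣ ℓ∣n)

prime∣^⇒∣ : ∀ {ℓ} m n → Prime ℓ → + ℓ ℤ.∣ m ^ n → + ℓ ℤ.∣ m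
prime∣^⇒∣ m zero    ℓ-prime ℓ∣1 = ⊥-elim (prime⇒∤1 ℓ-prime ℓ∣1)
prime∣^⇒∣ m (suc n) ℓ-prime ℓ∣mᵐ⁺¹ with euclidsLemmaℤ m (m ^ n) ℓ-prime ℓ∣mᵐ⁺¹
... | inj₁ ℓ∣m  = ℓ∣m
... | inj₂ ℓ∣mⁿ = prime∣^⇒∣ m n ℓ-prime ℓ∣mⁿ

∣0ℤ : ∀ n → + n ℤ.∣ 0ℤ
∣0ℤ n = divides 0ℤ refl

∃primeDivisor : ∀ n → .{{NonTrivial n}} → ∃ λ ℓ → Prime ℓ × ℓ ∣ n
∃primeDivisor n with factorise n {{nonTrivial⇒nonZero n}}
... | record { factors = [] ; isFactorisation = n≡1 } = ⊥-elim (<⇒≢ (nonTrivial⇒n>1 n) (sym n≡1))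
... | record { factors = ℓ ∷ ℓs ; isFactorisation = n≡ℓℓs ; factorsPrime = ℓ-prime ∷ _ } =
  ℓ , ℓ-prime , subst (ℓ ∣_) (sym n≡ℓℓs) (m∣m*n (product ℓs))

noCommonPrime⇒coprime : ∀ {m n} → (∀ {ℓ} → Prime ℓ → ℓ ∣ m → ℓ ∣ n → ⊥) → Coprime m n
noCommonPrime⇒coprime noCommon {zero} (0∣m , 0∣n) =
  ⊥-elim (noCommon prime[2] (∣-trans (2 ∣0) 0∣m) (∣-trans (2 ∣0) 0∣n))
noCommonPrime⇒coprime noCommon {suc zero} _ = refl
noCommonPrime⇒coprime noCommon {d@(suc (suc _))} (d∣m , d∣n)
  with ℓ , ℓ-prime , ℓ∣d ← ∃primeDivisor d =
  ⊥-elim (noCommon ℓ-prime (∣-trans ℓ∣d d∣m) (∣-trans ℓ∣d d∣n))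

module ArithProperties (p q : ℤ) where
  open Arith p q
  open Zτ

  mul-comm : ∀ a b → mul a b ≡ mul b a
  mul-comm (mk x y) (mk u v) = cong₂ mk (re-comm x y u v q) (im-comm x y u v p)
    where
    re-comm : ∀ x y u v q → x * u - q * (y * v) ≡ u * x - q * (v * y)
    re-comm = solve-∀
    im-comm : ∀ x y u v p → x * v + y * u + p * (y * v) ≡ u * y + v * x + p * (v * y)
    im-comm = solve-∀

  pτ-split : ∀ s → add (mul (mk 0ℤ p) s) (mul s (mk 1ℤ (- p))) ≡ s
  pτ-split (mk x y) = cong₂ mk (re-split x y p q) (im-split x y p)
    where
    re-split : ∀ x y p q → (0ℤ * x - q * (p * y)) + (x * 1ℤ - q * (y * - p)) ≡ x
    re-split = solve-∀
    im-split : ∀ x y p → (0ℤ * y + p * x + p * (p * y)) + (x * - p + y * 1ℤ + p * (y * - p)) ≡ y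
    im-split = solve-∀

  ∣re∧∣im⇒principal : ∀ {n x y} → n ℤ.∣ x → n ℤ.∣ y → principal n (mk x y)
  ∣re∧∣im⇒principal {n} (divides c refl) (divides d refl) =
    mk c d , cong₂ mk (re-eq c d n q) (im-eq c d n p)
    where
    re-eq : ∀ c d n q → c * n ≡ n * c - q * (0ℤ * d)
    re-eq = solve-∀
    im-eq : ∀ c d n p → d * n ≡ n * d + 0ℤ * c + p * (0ℤ * d)
    im-eq = solve-∀

  ideal-mulʳ : ∀ {I} → IsIdeal I → ∀ {a} r → I a → I (mul a r)
  ideal-mulʳ {I} (_ , _ , mul-closed) {a} r a∈I =
    subst I (mul-comm r a) (mul-closed r a a∈I)

  Prod⊆∩ : ∀ {I J} → IsIdeal I → IsIdeal J → ∀ {x} → Prod I J x → I x × J x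
  Prod⊆∩ (0∈I , _) (0∈J , _) pzero = 0∈I , 0∈J
  Prod⊆∩ I-ideal (_ , _ , J-mul) (pgen {a} {b} a∈I b∈J) = ideal-mulʳ I-ideal b a∈I , J-mul a b b∈J
  Prod⊆∩ I-ideal@(_ , I-add , _) J-ideal@(_ , J-add , _) (padd {x} {y} x∈IJ y∈IJ) =
    I-add x y (proj₁ (Prod⊆∩ I-ideal J-ideal x∈IJ)) (proj₁ (Prod⊆∩ I-ideal J-ideal y∈IJ)) ,
    J-add x y (proj₂ (Prod⊆∩ I-ideal J-ideal x∈IJ)) (proj₂ (Prod⊆∩ I-ideal J-ideal y∈IJ))

  primeIdeal-∉-pow : ∀ {P} → IsPrimeIdeal P → ∀ {t} → ¬ P t → ∀ n → ¬ P (pow t n)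
  primeIdeal-∉-pow (_ , 1∉P , _) t∉P zero = 1∉P
  primeIdeal-∉-pow {P} P-prime@(_ , _ , P-prime-mul) {t} t∉P (suc n) tⁿ⁺¹∈P
    with P-prime-mul t (pow t n) tⁿ⁺¹∈P
  ... | inj₁ t∈P  = t∉P t∈P
  ... | inj₂ tⁿ∈P = primeIdeal-∉-pow P-prime t∉P n tⁿ∈P

  norm : Zτ → ℤ
  norm (mk x y) = x * x + p * x * y + q * y * y

  norm-mul : ∀ a b → norm (mul a b) ≡ norm a * norm b
  norm-mul (mk x y) (mk u v) = norm-mul′ x y u v p q
    where
    norm-mul′ : ∀ x y u v p q →
      (x * u - q * (y * v)) * (x * u - q * (y * v))
        + p * (x * u - q * (y * v)) * (x * v + y * u + p * (y * v))
        + q * (x * v + y * u + p * (y * v)) * (x * v + y * u + p * (y * v))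
      ≡ (x * x + p * x * y + q * y * y) * (u * u + p * u * v + q * v * v)
    norm-mul′ = solve-∀

  norm-pow : ∀ t n → norm (pow t n) ≡ norm t ^ n
  norm-pow t zero    = norm-one p q
    where
    norm-one : ∀ p q → 1ℤ * 1ℤ + p * 1ℤ * 0ℤ + q * 0ℤ * 0ℤ ≡ 1ℤ
    norm-one = solve-∀
  norm-pow t (suc n) = trans (norm-mul t (pow t n)) (cong (norm t *_) (norm-pow t n))

  norm-τ : norm τ ≡ q
  norm-τ = norm-τ′ p q
    where
    norm-τ′ : ∀ p q → 0ℤ * 0ℤ + p * 0ℤ * 1ℤ + q * 1ℤ * 1ℤ ≡ q
    norm-τ′ = solve-∀

  norm-τbar : norm τbar ≡ q
  norm-τbar = norm-τbar′ p q
    where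
    norm-τbar′ : ∀ p q → p * p + p * p * -1ℤ + q * -1ℤ * -1ℤ ≡ q
    norm-τbar′ = solve-∀

  ∣re∧∣im⇒∣norm : ∀ {n x y} → n ℤ.∣ x → n ℤ.∣ y → n ℤ.∣ norm (mk x y)
  ∣re∧∣im⇒∣norm {x = x} {y} n∣x n∣y =
    ∣m∣n⇒∣m+n (∣m∣n⇒∣m+n (∣m⇒∣m*n x n∣x) (∣m⇒∣m*n y (∣n⇒∣m*n p n∣x))) (∣n⇒∣m*n (q * y) n∣y)

  -- τ ↦ c; a ring homomorphism ℤ[τ] → ℤ/qℤ when c² = p c, i.e. c is a root of X² - pX + q mod q.
  ev : ℤ → Zτ → ℤ
  ev c (mk x y) = x + c * y

  ev-0 : ∀ a → ev 0ℤ a ≡ re a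
  ev-0 (mk x y) = +-identityʳ x

  ev-add : ∀ c a b → ev c (add a b) ≡ ev c a + ev c b
  ev-add c (mk x y) (mk u v) = ev-add′ x y u v c
    where
    ev-add′ : ∀ x y u v c → (x + u) + c * (y + v) ≡ (x + c * y) + (u + c * v)
    ev-add′ = solve-∀

  ev-mul : ∀ c → p * c ≡ c * c → ∀ a b → ev c (mul a b) ≡ ev c a * ev c b - q * (im a * im b)
  ev-mul c pc≡c² (mk x y) (mk u v) = begin
    (x * u - q * (y * v)) + c * (x * v + y * u + p * (y * v))
      ≡⟨ expand x y u v c p q ⟩
    x * u + c * (x * v + y * u) + (p * c) * (y * v) - q * (y * v)
      ≡⟨ cong (λ e → x * u + c * (x * v + y * u) + e * (y * v) - q * (y * v)) pc≡c² ⟩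
    x * u + c * (x * v + y * u) + (c * c) * (y * v) - q * (y * v)
      ≡⟨ factor x y u v c q ⟩
    (x + c * y) * (u + c * v) - q * (y * v) ∎
    where
    open ≡-Reasoning
    expand : ∀ x y u v c p q → (x * u - q * (y * v)) + c * (x * v + y * u + p * (y * v))
                             ≡ x * u + c * (x * v + y * u) + (p * c) * (y * v) - q * (y * v)
    expand = solve-∀
    factor : ∀ x y u v c q → x * u + c * (x * v + y * u) + (c * c) * (y * v) - q * (y * v)
                           ≡ (x + c * y) * (u + c * v) - q * (y * v)
    factor = solve-∀

  Ker : ℕ → ℤ → Subset
  Ker ℓ c a = + ℓ ℤ.∣ ev c a

  ∣re∧∣im⇒∈Ker : ∀ {ℓ x y} c → + ℓ ℤ.∣ x → + ℓ ℤ.∣ y → Ker ℓ c (mk x y)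
  ∣re∧∣im⇒∈Ker c ℓ∣x ℓ∣y = ∣m∣n⇒∣m+n ℓ∣x (∣n⇒∣m*n c ℓ∣y)

  Ker-isPrimeIdeal : ∀ {ℓ} c → p * c ≡ c * c → Prime ℓ → + ℓ ℤ.∣ q → IsPrimeIdeal (Ker ℓ c)
  Ker-isPrimeIdeal {ℓ} c pc≡c² ℓ-prime ℓ∣q = (0∈Ker , add-closed , mul-closed) , 1∉Ker , prime-mul
    where
    ℓ∣_ : ℤ → Set
    ℓ∣ n = + ℓ ℤ.∣ n

    ℓ∣ev-mul⇒ℓ∣ev*ev : ∀ a b → ℓ∣ ev c (mul a b) → ℓ∣ (ev c a * ev c b)
    ℓ∣ev-mul⇒ℓ∣ev*ev a b ℓ∣ev =
      ∣m+n∣n⇒∣m (subst ℓ∣_ (ev-mul c pc≡c² a b) ℓ∣ev) (∣m⇒∣-m (∣m⇒∣m*n (im a * im b) ℓ∣q))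

    0∈Ker : Ker ℓ c zer
    0∈Ker = ∣re∧∣im⇒∈Ker c (∣0ℤ ℓ) (∣0ℤ ℓ)

    add-closed : ∀ a b → Ker ℓ c a → Ker ℓ c b → Ker ℓ c (add a b)
    add-closed a b ℓ∣a ℓ∣b = subst ℓ∣_ (sym (ev-add c a b)) (∣m∣n⇒∣m+n ℓ∣a ℓ∣b)

    mul-closed : ∀ r a → Ker ℓ c a → Ker ℓ c (mul r a)
    mul-closed r a ℓ∣a = subst ℓ∣_ (sym (ev-mul c pc≡c² r a))
      (∣m∣n⇒∣m-n (∣n⇒∣m*n (ev c r) ℓ∣a) (∣m⇒∣m*n (im r * im a) ℓ∣q))

    1∉Ker : ¬ Ker ℓ c one
    1∉Ker ℓ∣1+c0 = prime⇒∤1 ℓ-prime (subst ℓ∣_ (cong (_+_ 1ℤ) (*-zeroʳ c)) ℓ∣1+c0)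

    prime-mul : ∀ a b → Ker ℓ c (mul a b) → Ker ℓ c a ⊎ Ker ℓ c b
    prime-mul a b ℓ∣ab = euclidsLemmaℤ (ev c a) (ev c b) ℓ-prime (ℓ∣ev-mul⇒ℓ∣ev*ev a b ℓ∣ab)

module Splitting (q : ℕ) (p : ℤ) (p-unit : p ≡ 1ℤ ⊎ p ≡ -1ℤ)
                 {ℓ : ℕ} (ℓ-prime : Prime ℓ) (ℓ∣q : + ℓ ℤ.∣ + q) where
  open Arith p (+ q)
  open ArithProperties p (+ q)

  P₁ P₂ : Subset
  P₁ = Ker ℓ 0ℤ
  P₂ = Ker ℓ p

  P₁-prime : IsPrimeIdeal P₁
  P₁-prime = Ker-isPrimeIdeal 0ℤ (*-zeroʳ p) ℓ-prime ℓ∣q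

  P₂-prime : IsPrimeIdeal P₂
  P₂-prime = Ker-isPrimeIdeal p refl ℓ-prime ℓ∣q

  ℓ∤p : ¬ (+ ℓ ℤ.∣ p)
  ℓ∤p = prime⇒∤±1 ℓ-prime p-unit

  τ∈P₁ : P₁ τ
  τ∈P₁ = ∣0ℤ ℓ

  τ∉P₂ : ¬ P₂ τ
  τ∉P₂ ℓ∣0+p1 = ℓ∤p (subst (+ ℓ ℤ.∣_) (trans (+-identityˡ (p * 1ℤ)) (*-identityʳ p)) ℓ∣0+p1)

  τbar∉P₁ : ¬ P₁ τbar
  τbar∉P₁ ℓ∣p+0 = ℓ∤p (subst (+ ℓ ℤ.∣_) (ev-0 τbar) ℓ∣p+0)

  P₁≉P₂ : ¬ (P₁ ≐ P₂)
  P₁≉P₂ P₁≐P₂ = τ∉P₂ (proj₁ (P₁≐P₂ τ) τ∈P₁)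

  P₁∩P₂⊆ℓ : ∀ {x} → P₁ x → P₂ x → principal (+ ℓ) x
  P₁∩P₂⊆ℓ {mk x y} x∈P₁ x∈P₂ = ∣re∧∣im⇒principal ℓ∣x ℓ∣y
    where
    ℓ∣x : + ℓ ℤ.∣ x
    ℓ∣x = subst (+ ℓ ℤ.∣_) (ev-0 (mk x y)) x∈P₁
    ℓ∣y : + ℓ ℤ.∣ y
    ℓ∣y with euclidsLemmaℤ p y ℓ-prime (∣m+n∣m⇒∣n x∈P₂ ℓ∣x)
    ... | inj₁ ℓ∣p = ⊥-elim (ℓ∤p ℓ∣p)
    ... | inj₂ ℓ∣y = ℓ∣y

  ℓ⊆P₁P₂ : ∀ {x} → principal (+ ℓ) x → Prod P₁ P₂ x
  ℓ⊆P₁P₂ (r , refl) = subst (Prod P₁ P₂) (pτ-split ℓr)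
    (padd (pgen {a = mk 0ℤ p} {b = ℓr} pτ∈P₁ (ℓr∈Ker p P₂-prime))
          (pgen {a = ℓr} {b = mk 1ℤ (- p)} (ℓr∈Ker 0ℤ P₁-prime) 1-pτ∈P₂))
    where
    ℓr : Zτ
    ℓr = mul (mk (+ ℓ) 0ℤ) r
    ℓr∈Ker : ∀ c → IsPrimeIdeal (Ker ℓ c) → Ker ℓ c ℓr
    ℓr∈Ker c (Ker-ideal , _) = ideal-mulʳ Ker-ideal {mk (+ ℓ) 0ℤ} r (∣re∧∣im⇒∈Ker c ∣-refl (∣0ℤ ℓ))
    pτ∈P₁ : P₁ (mk 0ℤ p)
    pτ∈P₁ = ∣0ℤ ℓ
    1-pτ∈P₂ : P₂ (mk 1ℤ (- p))
    1-pτ∈P₂ = subst (+ ℓ ℤ.∣_) (sym (1-u²≡0 p-unit)) (∣0ℤ ℓ)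

  splits : Splits ℓ
  splits = P₁ , P₂ , P₁-prime , P₂-prime , P₁≉P₂ ,
    λ x → ℓ⊆P₁P₂ , λ x∈P₁P₂ → let x∈P₁ , x∈P₂ = Prod⊆∩ (proj₁ P₁-prime) (proj₁ P₂-prime) x∈P₁P₂
                              in P₁∩P₂⊆ℓ x∈P₁ x∈P₂

  τʷ∉P₂ : ∀ w → ¬ P₂ (pow τ w)
  τʷ∉P₂ = primeIdeal-∉-pow P₂-prime τ∉P₂

  τbarʷ∉P₁ : ∀ w → ¬ P₁ (pow τbar w)
  τbarʷ∉P₁ = primeIdeal-∉-pow P₁-prime τbar∉P₁

module PowersOfτ (q : ℕ) (p : ℤ) (p-unit : p ≡ 1ℤ ⊎ p ≡ -1ℤ) where
  open Arith p (+ q)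
  open ArithProperties p (+ q)

  ∣re∧∣im⇒∣q : ∀ {t ℓ a b} → norm t ≡ + q → ∀ w → mk a b ≡ pow t w →
                Prime ℓ → + ℓ ℤ.∣ a → + ℓ ℤ.∣ b → + ℓ ℤ.∣ + q
  ∣re∧∣im⇒∣q {t} {ℓ} {a} {b} norm-t w ab≡tʷ ℓ-prime ℓ∣a ℓ∣b =
    prime∣^⇒∣ (+ q) w ℓ-prime (subst (+ ℓ ℤ.∣_) norm-ab≡qʷ (∣re∧∣im⇒∣norm ℓ∣a ℓ∣b))
    where
    open ≡-Reasoning
    norm-ab≡qʷ : norm (mk a b) ≡ (+ q) ^ w
    norm-ab≡qʷ = begin
      norm (mk a b)   ≡⟨ cong norm ab≡tʷ ⟩
      norm (pow t w)  ≡⟨ norm-pow t w ⟩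
      norm t ^ w      ≡⟨ cong (_^ w) norm-t ⟩
      (+ q) ^ w       ∎

  noCommonPrime : ∀ w {a b} → (mk a b ≡ pow τ w ⊎ mk a b ≡ pow τbar w) →
                  ∀ {ℓ} → Prime ℓ → + ℓ ℤ.∣ a → + ℓ ℤ.∣ b → ⊥
  noCommonPrime w (inj₁ ab≡τʷ) ℓ-prime ℓ∣a ℓ∣b =
    τʷ∉P₂ w (subst P₂ ab≡τʷ (∣re∧∣im⇒∈Ker p ℓ∣a ℓ∣b))
    where open Splitting q p p-unit ℓ-prime (∣re∧∣im⇒∣q norm-τ w ab≡τʷ ℓ-prime ℓ∣a ℓ∣b)
  noCommonPrime w (inj₂ ab≡τbarʷ) ℓ-prime ℓ∣a ℓ∣b =
    τbarʷ∉P₁ w (subst P₁ ab≡τbarʷ (∣re∧∣im⇒∈Ker 0ℤ ℓ∣a ℓ∣b))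
    where open Splitting q p p-unit ℓ-prime (∣re∧∣im⇒∣q norm-τbar w ab≡τbarʷ ℓ-prime ℓ∣a ℓ∣b)

lemma4p2 : (q : ℕ) → 2 ≤ q → (p : ℤ) → (p ≡ 1ℤ ⊎ p ≡ -1ℤ) →
    ((ℓ : ℕ) → Prime ℓ → ℓ ∣ q → Arith.Splits p (+ q) ℓ)
    × ((w : ℕ) → 2 ≤ w → (a b : ℤ) →
        (mk a b ≡ Arith.pow p (+ q) (Arith.τ p (+ q)) w
          ⊎ mk a b ≡ Arith.pow p (+ q) (Arith.τbar p (+ q)) w) →
        gcd a b ≡ 1ℤ)
lemma4p2 q _ p p-unit =
  (λ ℓ ℓ-prime ℓ∣q → Splitting.splits q p p-unit ℓ-prime (∣ᵤ⇒∣ ℓ∣q)) ,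
  λ w _ a b ab≡pow → cong +_ (coprime⇒gcd≡1 (noCommonPrime⇒coprime λ ℓ-prime ℓ∣a ℓ∣b →
    PowersOfτ.noCommonPrime q p p-unit w ab≡pow ℓ-prime (∣ᵤ⇒∣ ℓ∣a) (∣ᵤ⇒∣ ℓ∣b)))
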